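{- Let $M$ be a cyclic partial multiplication matrix and let $\pi^\#\in\mathsf{Grid}^\#(M)$ be a gridded $M$-coil with points $v_1,\dots,v_n$ (ordered as in the definition of a gridded coil). Then for every $1<i<n$, removing the single point $v_i$ produces an $M$-divisible gridded permutation; specifically $$\pi^\#-v_i=\sigma^\#\boxplus\tau^\#,$$ where $\sigma^\#$ and $\tau^\#$ are the gridded subpermutations on the points $v_{i+1},\dots,v_n$ and $v_1,\dots,v_{i-1}$, respectively.
   Context: A gridding matrix is a matrix with entries in $\{0,1,-1\}$ ($m$ columns, $n$ rows; $M_{ij}$ in column $i$ from the left, row $j$ from the bottom). An $M$-gridding of a permutation is a division of its plot by vertical and horizontal lines into cells, each point interior to a cell, with cell $ij$ empty if $M_{ij}=0$, increasing if $M_{ij}=1$, decreasing if $M_{ij}=-1$; $\mathsf{Grid}^\#(M)$ is the set of $M$-gridded permutations, and subpermutations inherit the gridding. The row-column graph $G_M$ is the bipartite graph on columns and rows with edge $ij'$ iff $M_{ij}\neq0$; $M$ is cyclic if $G_M$ is isomorphic to a cycle, of length $\ell$ say. A partial multiplication matrix is a gridding matrix with fixed $c_i,r_j\in\{\pm1\}$ such that $M_{ij}=c_ir_j$ whenever $M_{ij}\ne0$; column $i$ is oriented left-to-right if $c_i=1$ and right-to-left otherwise, row $j$ bottom-to-top if $r_j=1$ and top-to-bottom otherwise. The orientation digraph $D_{\pi^\#}$ has an arc $x\to y$ between points sharing a column (resp. row) when $x$ precedes $y$ in its orientation. The $M$-sum $\sigma^\#\boxplus\tau^\#$ is the $M$-gridded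 permutation whose cell $ij$ contains the points of cell $ij$ of both, each keeping their relative positions, with each point of $\sigma^\#$ preceding each point of $\tau^\#$ in the orientation of every column and row; a gridded permutation is $M$-divisible if it is an $M$-sum of two nonempty gridded permutations. A gridded $M$-coil is an $M$-gridded permutation with $n>\ell$ points, an ordering $v_1,\dots,v_n$ of its points and a labelling $1,\dots,\ell$ of the non-zero cells with (C1) $v_i$ in cell $i\bmod\ell$ (residues in $\{1,\dots,\ell\}$); (C2) $v_{i-1}\to v_i$ for $1<i\le n$; (C3) $v_i\to v_{i-\ell-1}$ for $\ell+1<i\le n$; (C4) $v_{\ell+1}\to v_1$. -}

module Defs where

open import Data.Nat using (ℕ; zero; suc; _+_; _<_; _≤_)
import Data.Nat as ℕ
open import Data.Fin using (Fin; toℕ)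
import Data.Fin as F
open import Data.Integer using (ℤ; 0ℤ; 1ℤ; -1ℤ) renaming (_*_ to _*ℤ_)
open import Data.Product using (Σ; ∃; ∃-syntax; _×_; _,_; proj₁; proj₂)
open import Data.Sum using (_⊎_; inj₁; inj₂)
open import Data.Empty using (⊥)
open import Data.Unit using (⊤)
open import Data.Refinement using (Refinement; value; _,_)
open import Data.Irrelevant using ([_])
open import Relation.Nullary using (¬_)
open import Relation.Binary.PropositionalEquality using (_≡_; _≢_; refl; cong)

-- Gridding matrices: m columns, k rows; entry i j = M_{ij}
-- (column i from the left, row j from the bottom; 0-based indices).

record GriddingMatrix (m k : ℕ) : Set where
  field
    entry    : Fin m → Fin k → ℤ
    entry-ok : ∀ i j → entry i j ≡ 0ℤ ⊎ entry i j ≡ 1ℤ ⊎ entry i j ≡ -1ℤ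
open GriddingMatrix public

-- M-gridded permutations whose points form the type P.
-- A point p is plotted at (x p , y p); coordinates are pairwise distinct
-- (so the plot is that of a permutation, up to order-isomorphism).
-- p lies in cell (col p , row p).  Monotonicity of col in x and of row in
-- y is exactly the existence of vertical / horizontal grid lines with
-- every point interior to its cell.

record Gridded {m k : ℕ} (M : GriddingMatrix m k) (P : Set) : Set where
  field
    x     : P → ℕ
    y     : P → ℕ
    x-inj : ∀ p q → x p ≡ x q → p ≡ q
    y-inj : ∀ p q → y p ≡ y q → p ≡ q
    col   : P → Fin m
    row   : P → Fin k
    col-mono : ∀ p q → x p < x q → col p F.≤ col q
    row-mono : ∀ p q → y p < y q → row p F.≤ row q
    cell-nonzero : ∀ p → entry M (col p) (row p) ≢ 0ℤ
    cell-inc : ∀ p q → col p ≡ col q → row p ≡ row q →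
               entry M (col p) (row p) ≡ 1ℤ → x p < x q → y p < y q
    cell-dec : ∀ p q → col p ≡ col q → row p ≡ row q →
               entry M (col p) (row p) ≡ -1ℤ → x p < x q → y q < y p
open Gridded public

Grid# : {m k : ℕ} → GriddingMatrix m k → ℕ → Set
Grid# M n = Gridded M (Fin n)

restrict : ∀ {m k} {M : GriddingMatrix m k} {P : Set} →
           Gridded M P → (Q : P → Set) → Gridded M (Refinement P Q)
restrict {M = M} π Q = record
  { x = λ p → x π (value p)
  ; y = λ p → y π (value p)
  ; x-inj = λ { (p , _) (q , _) e → cong′ (x-inj π p q e) }
  ; y-inj = λ { (p , _) (q , _) e → cong′ (y-inj π p q e) }
  ; col = λ p → col π (value p)
  ; row = λ p → row π (value p)
  ; col-mono = λ p q → col-mono π (value p) (value q)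
  ; row-mono = λ p q → row-mono π (value p) (value q)
  ; cell-nonzero = λ p → cell-nonzero π (value p)
  ; cell-inc = λ p q → cell-inc π (value p) (value q)
  ; cell-dec = λ p q → cell-dec π (value p) (value q)
  }
  where
  cong′ : ∀ {p q} {a : _} {b : _} → p ≡ q →
          _≡_ {A = Refinement _ Q} (p , a) (q , b)
  cong′ refl = refl

delete : ∀ {m k} {M : GriddingMatrix m k} {P : Set} →
         Gridded M P → (v : P) → Gridded M (Refinement P (λ p → p ≢ v))
delete π v = restrict π (λ p → p ≢ v)

record PMM {m k : ℕ} (M : GriddingMatrix m k) : Set where
  field
    c : Fin m → ℤ
    r : Fin k → ℤ
    c-sign : ∀ i → c i ≡ 1ℤ ⊎ c i ≡ -1ℤ
    r-sign : ∀ j → r j ≡ 1ℤ ⊎ r j ≡ -1ℤ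
    mult   : ∀ i j → entry M i j ≢ 0ℤ → entry M i j ≡ c i *ℤ r j
open PMM public

Adj : ∀ {m k} → GriddingMatrix m k → Fin m ⊎ Fin k → Fin m ⊎ Fin k → Set
Adj M (inj₁ i) (inj₂ j) = entry M i j ≢ 0ℤ
Adj M (inj₂ j) (inj₁ i) = entry M i j ≢ 0ℤ
Adj M (inj₁ _) (inj₁ _) = ⊥
Adj M (inj₂ _) (inj₂ _) = ⊥

CycSucc : (ℓ : ℕ) → Fin ℓ → Fin ℓ → Set
CycSucc ℓ a b = toℕ b ≡ suc (toℕ a) ⊎ (suc (toℕ a) ≡ ℓ × toℕ b ≡ 0)

-- G_M is isomorphic to the cycle graph C_ℓ (ℓ ≥ 3).
IsCyclic : ∀ {m k} → GriddingMatrix m k → ℕ → Set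
IsCyclic {m} {k} M ℓ =
  3 ≤ ℓ ×
  Σ (Fin ℓ → Fin m ⊎ Fin k) λ w →
    (∀ a b → w a ≡ w b → a ≡ b) ×
    (∀ u → ∃[ a ] w a ≡ u) ×
    (∀ a b → (Adj M (w a) (w b) → CycSucc ℓ a b ⊎ CycSucc ℓ b a) ×
             (CycSucc ℓ a b ⊎ CycSucc ℓ b a → Adj M (w a) (w b)))

module _ {m k : ℕ} {M : GriddingMatrix m k} (O : PMM M) {P : Set}
         (π : Gridded M P) where

  ColPrec : P → P → Set
  ColPrec p q = (c O (col π p) ≡ 1ℤ × x π p < x π q)
              ⊎ (c O (col π p) ≡ -1ℤ × x π q < x π p)

  RowPrec : P → P → Set
  RowPrec p q = (r O (row π p) ≡ 1ℤ × y π p < y π q)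
              ⊎ (r O (row π p) ≡ -1ℤ × y π q < y π p)

  Arc : P → P → Set
  Arc p q = (col π p ≡ col π q × ColPrec p q) ⊎ (row π p ≡ row π q × RowPrec p q)

  -- π# = σ# ⊞ τ# where σ# = restrict π S and τ# = restrict π T:
  -- S, T partition the points and every point of σ# precedes every point of
  -- τ# in the orientation of every column and every row they share.
  -- (The M-sum is uniquely determined by σ#, τ#, so this is exactly the
  -- equation π# = σ# ⊞ τ#.)
  IsMSum : (S T : P → Set) → Set
  IsMSum S T =
    (∀ p → S p ⊎ T p) ×
    (∀ p → S p → T p → ⊥) ×
    (∀ s t → S s → T t → col π s ≡ col π t → ColPrec s t) ×
    (∀ s t → S s → T t → row π s ≡ row π t → RowPrec s t)

  IsMDivisibleVia : (S T : P → Set) → Set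
  IsMDivisibleVia S T = IsMSum S T × (∃[ p ] S p) × (∃[ p ] T p)

-- Gridded M-coils (0-based indices: v 0 , … , v (n-1); cell labels
-- 0 , … , ℓ-1).  lab is a bijection from Fin ℓ onto the non-zero cells.

record IsCoil {m k : ℕ} {M : GriddingMatrix m k} (O : PMM M) (ℓ : ℕ)
              {n : ℕ} (π : Grid# M n) : Set where
  field
    n>ℓ   : ℓ < n
    v     : Fin n → Fin n
    v-inj : ∀ a b → v a ≡ v b → a ≡ b
    v-sur : ∀ p → ∃[ a ] v a ≡ p
    lab     : Fin ℓ → Fin m × Fin k
    lab-inj : ∀ a b → lab a ≡ lab b → a ≡ b
    lab-nz  : ∀ a → entry M (proj₁ (lab a)) (proj₂ (lab a)) ≢ 0ℤ
    lab-sur : ∀ i j → entry M i j ≢ 0ℤ → ∃[ a ] lab a ≡ (i , j)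
    C1 : ∀ (j : Fin n) (a : Fin ℓ) → (∃[ q ] toℕ j ≡ q ℕ.* ℓ + toℕ a) →
         (col π (v j) , row π (v j)) ≡ lab a
    C2 : ∀ (a b : Fin n) → toℕ b ≡ suc (toℕ a) → Arc O π (v a) (v b)
    -- (C3) v_i → v_{i-ℓ-1}  (1-based ℓ+1 < i ≤ n)
    C3 : ∀ (a b : Fin n) → toℕ a ≡ toℕ b + suc ℓ → Arc O π (v a) (v b)
    C4 : ∀ (a b : Fin n) → toℕ a ≡ ℓ → toℕ b ≡ 0 → Arc O π (v a) (v b)
open IsCoil public

{-# OPTIONS --safe #-}
-- For a > b + 1, the point v_a precedes v_b in every column and row the two
-- share, so the later and the earlier points form an M-sum.  Within one cell
-- the column and row orientations agree, since M_ij = c_i r_j.  Points of one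
-- cell have indices congruent mod ℓ, and v_{b+ℓ} precedes v_b because the arc
-- (C3) from v_{b+ℓ} to v_{b-1} and the arc (C2) from v_{b-1} to v_b run along
-- one line (for b = 0 use (C4)); induction on the number of periods does the
-- rest.  Points in different cells of a common line lie in consecutively
-- labelled cells, since in the cycle G_M every line carries at most two
-- non-zero cells; an arc (C2) or (C3) leaving a point of v_a's cell then
-- reaches v_b.
module Submission where

open import Defs
open import Data.Nat using (ℕ; zero; suc; pred; _+_; _*_; _∸_; _<_; _≤_; z<s; s≤s; NonZero; >-nonZero; _%_; _/_)
import Data.Nat as ℕ
open import Data.Nat.Properties
  using (<-trans; ≤-<-trans; ≤-reflexive; <-irrefl; <-cmp; <⇒≤; <⇒≢; >⇒≢; <⇒≱; n<1+n; m<n⇒m<1+n; m≤m+n; m<n+m;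
         +-suc; +-comm; +-assoc; +-identityʳ; +-cancelˡ-≡; suc-injective; suc-pred; pred[n]≤n; 0≢1+n;
         m+[n∸m]≡n; [m+n]∸[m+o]≡n∸o; *-distribʳ-∸)
open import Data.Nat.DivMod using (_mod_; _divMod_; module DivMod; m≡m%n+[m/n]*n; m%n<n; m%n%n≡m%n; [m+n]%n≡m%n; [m+kn]%n≡m%n; %-distribˡ-+)
open import Data.Fin as F using (Fin; toℕ; fromℕ<; inject₁)
open import Data.Fin.Properties using (toℕ-fromℕ<; fromℕ<-cong; toℕ-injective; toℕ<n; toℕ-inject₁)
open import Data.Integer using (ℤ; 0ℤ; 1ℤ; -1ℤ) renaming (_*_ to _*ℤ_)
open import Data.Product using (∃-syntax; _×_; _,_; proj₁; proj₂)
open import Data.Sum using (_⊎_; inj₁; inj₂; [_,_]′)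
import Data.Sum as Sum
open import Data.Sum.Properties using (inj₁-injective; inj₂-injective)
open import Data.Empty using (⊥; ⊥-elim-irr)
open import Data.Refinement using (Refinement; value; _,_)
open import Data.Irrelevant using ([_])
open import Function using (_∘_; case_of_)
open import Relation.Nullary using (¬_; yes; no; contradiction)
open import Relation.Binary.Definitions using (tri<; tri≈; tri>)
open import Relation.Binary.PropositionalEquality
  using (_≡_; _≢_; refl; sym; trans; cong; cong₂; subst; subst₂; module ≡-Reasoning)

open ≡-Reasoning

Before : ℤ → ℕ → ℕ → Set
Before s a b = (s ≡ 1ℤ × a < b) ⊎ (s ≡ -1ℤ × b < a)

1≢-1 : 1ℤ ≢ -1ℤ
1≢-1 ()

Before-irrefl : ∀ {s a} → ¬ Before s a a
Before-irrefl (inj₁ (_ , a<a)) = <-irrefl refl a<a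
Before-irrefl (inj₂ (_ , a<a)) = <-irrefl refl a<a

Before-trans : ∀ {s a b c} → Before s a b → Before s b c → Before s a c
Before-trans (inj₁ (s≡1 , a<b)) (inj₁ (_ , b<c)) = inj₁ (s≡1 , <-trans a<b b<c)
Before-trans (inj₂ (s≡-1 , b<a)) (inj₂ (_ , c<b)) = inj₂ (s≡-1 , <-trans c<b b<a)
Before-trans (inj₁ (s≡1 , _)) (inj₂ (s≡-1 , _)) = contradiction (trans (sym s≡1) s≡-1) 1≢-1
Before-trans (inj₂ (s≡-1 , _)) (inj₁ (s≡1 , _)) = contradiction (trans (sym s≡1) s≡-1) 1≢-1

Before-total : ∀ {s a b} → s ≡ 1ℤ ⊎ s ≡ -1ℤ → a ≢ b → Before s a b ⊎ Before s b a
Before-total {a = a} {b} s≡±1 a≢b with <-cmp a b | s≡±1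
... | tri< a<b _ _ | inj₁ s≡1  = inj₁ (inj₁ (s≡1 , a<b))
... | tri< a<b _ _ | inj₂ s≡-1 = inj₂ (inj₂ (s≡-1 , a<b))
... | tri≈ _ a≡b _ | _         = contradiction a≡b a≢b
... | tri> _ _ b<a | inj₁ s≡1  = inj₂ (inj₁ (s≡1 , b<a))
... | tri> _ _ b<a | inj₂ s≡-1 = inj₁ (inj₂ (s≡-1 , b<a))

data Line : Set where
  colLine rowLine : Line

line-pigeonhole : ∀ (d e e′ : Line) → d ≡ e ⊎ d ≡ e′ ⊎ e ≡ e′
line-pigeonhole colLine colLine _       = inj₁ refl
line-pigeonhole rowLine rowLine _       = inj₁ refl
line-pigeonhole colLine rowLine colLine = inj₂ (inj₁ refl)
line-pigeonhole rowLine colLine rowLine = inj₂ (inj₁ refl)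
line-pigeonhole colLine rowLine rowLine = inj₂ (inj₂ refl)
line-pigeonhole rowLine colLine colLine = inj₂ (inj₂ refl)

Cell : ℕ → ℕ → Set
Cell m k = Fin m × Fin k

LineIndex : ℕ → ℕ → Line → Set
LineIndex m _ colLine = Fin m
LineIndex _ k rowLine = Fin k

lineOf : ∀ {m k} (d : Line) → Cell m k → LineIndex m k d
lineOf colLine = proj₁
lineOf rowLine = proj₂

Collinear : ∀ {m k} → Line → Cell m k → Cell m k → Set
Collinear d a b = lineOf d a ≡ lineOf d b

cellEntry : ∀ {m k} → GriddingMatrix m k → Cell m k → ℤ
cellEntry M (i , j) = entry M i j

module Orientation {m k : ℕ} {M : GriddingMatrix m k} (O : PMM M) {P : Set} (π : Gridded M P) where

  cell : P → Cell m k
  cell p = col π p , row π p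

  SameLine : Line → P → P → Set
  SameLine d p q = Collinear d (cell p) (cell q)

  sign : Line → P → ℤ
  sign colLine p = c O (col π p)
  sign rowLine p = r O (row π p)

  coord : Line → P → ℕ
  coord colLine = x π
  coord rowLine = y π

  -- Precedes colLine and Precedes rowLine unfold to ColPrec and RowPrec.
  Precedes : Line → P → P → Set
  Precedes d p q = Before (sign d p) (coord d p) (coord d q)

  infix 4 _⊲_
  _⊲_ : P → P → Set
  p ⊲ q = ∀ d → SameLine d p q → Precedes d p q

  sign-±1 : ∀ d p → sign d p ≡ 1ℤ ⊎ sign d p ≡ -1ℤ
  sign-±1 colLine p = c-sign O (col π p)
  sign-±1 rowLine p = r-sign O (row π p)

  sign-cong : ∀ d {p q} → SameLine d p q → sign d p ≡ sign d q
  sign-cong colLine = cong (c O)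
  sign-cong rowLine = cong (r O)

  coord-injective : ∀ d {p q} → coord d p ≡ coord d q → p ≡ q
  coord-injective colLine = x-inj π _ _
  coord-injective rowLine = y-inj π _ _

  Precedes⇒≢ : ∀ d {p q} → Precedes d p q → p ≢ q
  Precedes⇒≢ d p≺p refl = Before-irrefl p≺p

  Precedes-trans : ∀ d {p q r} → SameLine d p q → Precedes d p q → Precedes d q r → Precedes d p r
  Precedes-trans d pq p≺q q≺r = Before-trans p≺q (subst (λ s → Before s _ _) (sym (sign-cong d pq)) q≺r)

  Precedes-asym : ∀ d {p q} → SameLine d p q → Precedes d p q → ¬ Precedes d q p
  Precedes-asym d pq p≺q q≺p = Before-irrefl (Precedes-trans d pq p≺q q≺p)

  Precedes-total : ∀ d {p q} → SameLine d p q → p ≢ q → Precedes d p q ⊎ Precedes d q p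
  Precedes-total d pq p≢q =
    Sum.map₂ (subst (λ s → Before s _ _) (sign-cong d pq))
             (Before-total (sign-±1 d _) (p≢q ∘ coord-injective d))

  -- Because M_ij = c_i r_j, the monotonicity of a cell makes its column and
  -- row orientations agree on the points of the cell.
  colPrecedes⇒rowPrecedes : ∀ {p q} → cell p ≡ cell q → Precedes colLine p q → Precedes rowLine p q
  colPrecedes⇒rowPrecedes {p} {q} p~q = go (c-sign O (col π p)) (r-sign O (row π p))
    where
    cols = cong proj₁ p~q
    rows = cong proj₂ p~q

    entry-p : ∀ {s t} → c O (col π p) ≡ s → r O (row π p) ≡ t → cellEntry M (cell p) ≡ s *ℤ t
    entry-p c≡s r≡t = trans (mult O _ _ (cell-nonzero π p)) (cong₂ _*ℤ_ c≡s r≡t)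

    entry-q : ∀ {s t} → c O (col π p) ≡ s → r O (row π p) ≡ t → cellEntry M (cell q) ≡ s *ℤ t
    entry-q c≡s r≡t = trans (cong (cellEntry M) (sym p~q)) (entry-p c≡s r≡t)

    go : c O (col π p) ≡ 1ℤ ⊎ c O (col π p) ≡ -1ℤ → r O (row π p) ≡ 1ℤ ⊎ r O (row π p) ≡ -1ℤ →
         Precedes colLine p q → Precedes rowLine p q
    go (inj₁ c≡1) (inj₁ r≡1) (inj₁ (_ , x<)) = inj₁ (r≡1 , cell-inc π p q cols rows (entry-p c≡1 r≡1) x<)
    go (inj₁ c≡1) (inj₂ r≡-1) (inj₁ (_ , x<)) = inj₂ (r≡-1 , cell-dec π p q cols rows (entry-p c≡1 r≡-1) x<)
    go (inj₂ c≡-1) (inj₁ r≡1) (inj₂ (_ , x>)) =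
      inj₁ (r≡1 , cell-dec π q p (sym cols) (sym rows) (entry-q c≡-1 r≡1) x>)
    go (inj₂ c≡-1) (inj₂ r≡-1) (inj₂ (_ , x>)) =
      inj₂ (r≡-1 , cell-inc π q p (sym cols) (sym rows) (entry-q c≡-1 r≡-1) x>)
    go (inj₁ c≡1) _ (inj₂ (c≡-1 , _)) = contradiction (trans (sym c≡1) c≡-1) 1≢-1
    go (inj₂ c≡-1) _ (inj₁ (c≡1 , _)) = contradiction (trans (sym c≡1) c≡-1) 1≢-1

  rowPrecedes⇒colPrecedes : ∀ {p q} → cell p ≡ cell q → Precedes rowLine p q → Precedes colLine p q
  rowPrecedes⇒colPrecedes p~q p≺q
    with Precedes-total colLine (cong proj₁ p~q) (Precedes⇒≢ rowLine p≺q)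
  ... | inj₁ p≺q′ = p≺q′
  ... | inj₂ q≺p  = contradiction (colPrecedes⇒rowPrecedes (sym p~q) q≺p)
                                  (Precedes-asym rowLine (cong proj₂ p~q) p≺q)

  sameCell⇒⊲ : ∀ d {p q} → cell p ≡ cell q → Precedes d p q → p ⊲ q
  sameCell⇒⊲ colLine p~q p≺q colLine _ = p≺q
  sameCell⇒⊲ colLine p~q p≺q rowLine _ = colPrecedes⇒rowPrecedes p~q p≺q
  sameCell⇒⊲ rowLine p~q p≺q colLine _ = rowPrecedes⇒colPrecedes p~q p≺q
  sameCell⇒⊲ rowLine p~q p≺q rowLine _ = p≺q

  arc-line : ∀ {p q} → Arc O π p q → ∃[ d ] SameLine d p q × Precedes d p q
  arc-line (inj₁ arc) = colLine , arc
  arc-line (inj₂ arc) = rowLine , arc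

  arc⇒⊲ : ∀ {p q} → Arc O π p q → p ⊲ q
  arc⇒⊲ (inj₁ (_ , p≺q)) colLine _ = p≺q
  arc⇒⊲ (inj₁ (cols , p≺q)) rowLine rows = colPrecedes⇒rowPrecedes (cong₂ _,_ cols rows) p≺q
  arc⇒⊲ (inj₂ (rows , p≺q)) colLine cols = rowPrecedes⇒colPrecedes (cong₂ _,_ cols rows) p≺q
  arc⇒⊲ (inj₂ (_ , p≺q)) rowLine _ = p≺q

  ⊲-via-arc : ∀ {p q r} → cell p ≡ cell r → Arc O π p q → q ⊲ r → p ⊲ r
  ⊲-via-arc p~r arc q⊲r =
    let d , pq , p≺q = arc-line arc
        qr = trans (sym pq) (cong (lineOf d) p~r)
    in sameCell⇒⊲ d p~r (Precedes-trans d pq p≺q (q⊲r d qr))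

  ⊲-trans-sameCellˡ : ∀ {p q r} → cell p ≡ cell q → p ⊲ q → q ⊲ r → p ⊲ r
  ⊲-trans-sameCellˡ p~q p⊲q q⊲r d pr =
    let pq = cong (lineOf d) p~q
    in Precedes-trans d pq (p⊲q d pq) (q⊲r d (trans (sym pq) pr))

  ⊲-trans-sameCellʳ : ∀ {p q r} → cell q ≡ cell r → p ⊲ q → q ⊲ r → p ⊲ r
  ⊲-trans-sameCellʳ q~r p⊲q q⊲r d pr =
    let qr = cong (lineOf d) q~r
        pq = trans pr (sym qr)
    in Precedes-trans d pq (p⊲q d pq) (q⊲r d qr)

Neighbours : (ℓ : ℕ) → Fin ℓ → Fin ℓ → Set
Neighbours ℓ a b = CycSucc ℓ a b ⊎ CycSucc ℓ b a

CycSucc-functional : ∀ {ℓ} {a b b′ : Fin ℓ} → CycSucc ℓ a b → CycSucc ℓ a b′ → b ≡ b′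
CycSucc-functional (inj₁ b≡1+a) (inj₁ b′≡1+a) = toℕ-injective (trans b≡1+a (sym b′≡1+a))
CycSucc-functional {b = b} (inj₁ b≡1+a) (inj₂ (1+a≡ℓ , _)) = contradiction (trans b≡1+a 1+a≡ℓ) (<⇒≢ (toℕ<n b))
CycSucc-functional {b′ = b′} (inj₂ (1+a≡ℓ , _)) (inj₁ b′≡1+a) = contradiction (trans b′≡1+a 1+a≡ℓ) (<⇒≢ (toℕ<n b′))
CycSucc-functional (inj₂ (_ , b≡0)) (inj₂ (_ , b′≡0)) = toℕ-injective (trans b≡0 (sym b′≡0))

CycSucc-injective : ∀ {ℓ} {a a′ b : Fin ℓ} → CycSucc ℓ a b → CycSucc ℓ a′ b → a ≡ a′
CycSucc-injective (inj₁ b≡1+a) (inj₁ b≡1+a′) = toℕ-injective (suc-injective (trans (sym b≡1+a) b≡1+a′))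
CycSucc-injective (inj₁ b≡1+a) (inj₂ (_ , b≡0)) = contradiction (trans (sym b≡0) b≡1+a) 0≢1+n
CycSucc-injective (inj₂ (_ , b≡0)) (inj₁ b≡1+a′) = contradiction (trans (sym b≡0) b≡1+a′) 0≢1+n
CycSucc-injective (inj₂ (1+a≡ℓ , _)) (inj₂ (1+a′≡ℓ , _)) = toℕ-injective (suc-injective (trans 1+a≡ℓ (sym 1+a′≡ℓ)))

cycle-degree≤2 : ∀ {ℓ} {a b₁ b₂ b₃ : Fin ℓ} →
                 Neighbours ℓ a b₁ → Neighbours ℓ a b₂ → Neighbours ℓ a b₃ → b₁ ≢ b₂ → b₁ ≢ b₃ → b₂ ≡ b₃
cycle-degree≤2 (inj₁ s₁) (inj₁ s₂) _         b₁≢b₂ _     = contradiction (CycSucc-functional s₁ s₂) b₁≢b₂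
cycle-degree≤2 (inj₁ s₁) (inj₂ _)  (inj₁ s₃) _     b₁≢b₃ = contradiction (CycSucc-functional s₁ s₃) b₁≢b₃
cycle-degree≤2 (inj₁ _)  (inj₂ p₂) (inj₂ p₃) _     _     = CycSucc-injective p₂ p₃
cycle-degree≤2 (inj₂ p₁) (inj₂ p₂) _         b₁≢b₂ _     = contradiction (CycSucc-injective p₁ p₂) b₁≢b₂
cycle-degree≤2 (inj₂ p₁) (inj₁ _)  (inj₂ p₃) _     b₁≢b₃ = contradiction (CycSucc-injective p₁ p₃) b₁≢b₃
cycle-degree≤2 (inj₂ _)  (inj₁ s₂) (inj₁ s₃) _     _     = CycSucc-functional s₂ s₃

rowColumnGraph-degree≤2 : ∀ {m k ℓ} {M : GriddingMatrix m k} → IsCyclic M ℓ →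
                          ∀ {u u₁ u₂ u₃} → Adj M u u₁ → Adj M u u₂ → Adj M u u₃ →
                          u₁ ≢ u₂ → u₁ ≢ u₃ → u₂ ≡ u₃
rowColumnGraph-degree≤2 (_ , w , _ , w-sur , w-adj) {u} {u₁} {u₂} {u₃} uu₁ uu₂ uu₃ u₁≢u₂ u₁≢u₃
  with w-sur u | w-sur u₁ | w-sur u₂ | w-sur u₃
... | γ , refl | β₁ , refl | β₂ , refl | β₃ , refl =
  cong w (cycle-degree≤2 (proj₁ (w-adj γ β₁) uu₁) (proj₁ (w-adj γ β₂) uu₂) (proj₁ (w-adj γ β₃) uu₃)
                         (u₁≢u₂ ∘ cong w) (u₁≢u₃ ∘ cong w))

collinear-nonzero-unique : ∀ {m k ℓ} {M : GriddingMatrix m k} → IsCyclic M ℓ → ∀ d {a b c : Cell m k} →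
  cellEntry M a ≢ 0ℤ → cellEntry M b ≢ 0ℤ → cellEntry M c ≢ 0ℤ →
  Collinear d a b → Collinear d a c → a ≢ b → a ≢ c → b ≡ c
collinear-nonzero-unique cyc colLine {i , j₁} {_ , j₂} {_ , j₃} a≠0 b≠0 c≠0 refl refl a≢b a≢c =
  cong (i ,_) (inj₂-injective
    (rowColumnGraph-degree≤2 cyc {inj₁ i} {inj₂ j₁} {inj₂ j₂} {inj₂ j₃} a≠0 b≠0 c≠0
      (a≢b ∘ cong (i ,_) ∘ inj₂-injective) (a≢c ∘ cong (i ,_) ∘ inj₂-injective)))
collinear-nonzero-unique cyc rowLine {i₁ , j} {i₂ , _} {i₃ , _} a≠0 b≠0 c≠0 refl refl a≢b a≢c =
  cong (_, j) (inj₁-injective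
    (rowColumnGraph-degree≤2 cyc {inj₂ j} {inj₁ i₁} {inj₁ i₂} {inj₁ i₃} a≠0 b≠0 c≠0
      (a≢b ∘ cong (_, j) ∘ inj₁-injective) (a≢c ∘ cong (_, j) ∘ inj₁-injective)))

module _ (ℓ : ℕ) .{{_ : NonZero ℓ}} where

  ≡-mod⇒≡+multiple : ∀ {a b} → b ≤ a → a % ℓ ≡ b % ℓ → a ≡ b + (a / ℓ ∸ b / ℓ) * ℓ
  ≡-mod⇒≡+multiple {a} {b} b≤a a≡b = begin
    a                       ≡⟨ m+[n∸m]≡n b≤a ⟨
    b + (a ∸ b)             ≡⟨ cong (b +_) a∸b≡ ⟩
    b + (a / ℓ ∸ b / ℓ) * ℓ ∎
    where
    a∸b≡ : a ∸ b ≡ (a / ℓ ∸ b / ℓ) * ℓ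
    a∸b≡ = begin
      a ∸ b                                     ≡⟨ cong₂ _∸_ (m≡m%n+[m/n]*n a ℓ) (m≡m%n+[m/n]*n b ℓ) ⟩
      (a % ℓ + a / ℓ * ℓ) ∸ (b % ℓ + b / ℓ * ℓ) ≡⟨ cong (λ r → (r + a / ℓ * ℓ) ∸ (b % ℓ + b / ℓ * ℓ)) a≡b ⟩
      (b % ℓ + a / ℓ * ℓ) ∸ (b % ℓ + b / ℓ * ℓ) ≡⟨ [m+n]∸[m+o]≡n∸o (b % ℓ) _ _ ⟩
      a / ℓ * ℓ ∸ b / ℓ * ℓ                     ≡⟨ *-distribʳ-∸ ℓ (a / ℓ) (b / ℓ) ⟨
      (a / ℓ ∸ b / ℓ) * ℓ                       ∎

  ≡-mod⇒periods : ∀ {a b} → b < a → a % ℓ ≡ b % ℓ → ∃[ q ] a ≡ b + suc q * ℓ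
  ≡-mod⇒periods {a} {b} b<a a≡b with a / ℓ ∸ b / ℓ | ≡-mod⇒≡+multiple (<⇒≤ b<a) a≡b
  ... | zero  | a≡b+0 = contradiction (trans a≡b+0 (+-identityʳ b)) (>⇒≢ b<a)
  ... | suc q | a≡    = q , a≡

  suc-cong-mod : ∀ {a b} → a % ℓ ≡ b % ℓ → suc a % ℓ ≡ suc b % ℓ
  suc-cong-mod {a} {b} a≡b = begin
    suc a % ℓ           ≡⟨ %-distribˡ-+ 1 a ℓ ⟩
    (1 % ℓ + a % ℓ) % ℓ ≡⟨ cong (λ r → (1 % ℓ + r) % ℓ) a≡b ⟩
    (1 % ℓ + b % ℓ) % ℓ ≡⟨ %-distribˡ-+ 1 b ℓ ⟨
    suc b % ℓ           ∎

earlier : ∀ {n} (a : Fin n) (j : ℕ) {e : ℕ} → toℕ a ≡ j + e → ∃[ c ] toℕ c ≡ j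
earlier a j {e} a≡j+e = fromℕ< j<n , toℕ-fromℕ< j<n
  where j<n = ≤-<-trans (subst (j ≤_) (sym a≡j+e) (m≤m+n j e)) (toℕ<n a)

module Coil {m k ℓ n : ℕ} {M : GriddingMatrix m k} (O : PMM M) (cyc : IsCyclic M ℓ)
                 {π : Grid# M n} (C : IsCoil O ℓ π) where

  open Orientation O π

  2<ℓ : 2 < ℓ
  2<ℓ = proj₁ cyc

  1<ℓ : 1 < ℓ
  1<ℓ = <-trans (n<1+n 1) 2<ℓ

  instance
    ℓ-nonZero : NonZero ℓ
    ℓ-nonZero = >-nonZero (<-trans z<s 1<ℓ)

  cellAt : ℕ → Cell m k
  cellAt j = lab C (j mod ℓ)

  cell-v : ∀ a → cell (v C a) ≡ cellAt (toℕ a)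
  cell-v a = C1 C a (toℕ a mod ℓ) (toℕ a / ℓ , trans (DivMod.property (toℕ a divMod ℓ)) (+-comm (toℕ (toℕ a mod ℓ)) _))

  cellAt-≡⇒≡-mod : ∀ {a b} → cellAt a ≡ cellAt b → a % ℓ ≡ b % ℓ
  cellAt-≡⇒≡-mod {a} {b} a~b = begin
    a % ℓ         ≡⟨ toℕ-fromℕ< (m%n<n a ℓ) ⟨
    toℕ (a mod ℓ) ≡⟨ cong toℕ (lab-inj C _ _ a~b) ⟩
    toℕ (b mod ℓ) ≡⟨ toℕ-fromℕ< (m%n<n b ℓ) ⟩
    b % ℓ         ∎

  ≡-mod⇒cellAt-≡ : ∀ {a b} → a % ℓ ≡ b % ℓ → cellAt a ≡ cellAt b
  ≡-mod⇒cellAt-≡ {a} {b} a≡b = cong (lab C) (fromℕ<-cong _ _ a≡b (m%n<n a ℓ) (m%n<n b ℓ))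

  cellAt-suc : ∀ {a b} → cellAt a ≡ cellAt b → cellAt (suc a) ≡ cellAt (suc b)
  cellAt-suc a~b = ≡-mod⇒cellAt-≡ (suc-cong-mod ℓ (cellAt-≡⇒≡-mod a~b))

  cellAt-distinct : ∀ j {t} → 0 < t → t < ℓ → cellAt (t + j) ≢ cellAt j
  cellAt-distinct j {t} 0<t t<ℓ t+j~j with ≡-mod⇒periods ℓ (m<n+m j 0<t) (cellAt-≡⇒≡-mod t+j~j)
  ... | q , t+j≡ = <⇒≱ t<ℓ (subst (ℓ ≤_) (sym t≡) (m≤m+n ℓ (q * ℓ)))
    where
    t≡ : t ≡ suc q * ℓ
    t≡ = +-cancelˡ-≡ j _ _ (trans (+-comm j t) t+j≡)

  cellAt-nonzero : ∀ j → cellEntry M (cellAt j) ≢ 0ℤ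
  cellAt-nonzero j = lab-nz C (j mod ℓ)

  cellAt-suc-collinear : ∀ j → ∃[ d ] Collinear d (cellAt j) (cellAt (suc j))
  cellAt-suc-collinear j =
    let d , shared , _ = arc-line (C2 C ρ ρ⁺ (trans (toℕ-fromℕ< _) (cong suc (sym (toℕ-fromℕ< _)))))
    in d , subst₂ (Collinear d) (trans (cell-v ρ) ρ~j) (trans (cell-v ρ⁺) ρ⁺~j⁺) shared
    where
    ρ ρ⁺ : Fin n
    ρ  = fromℕ< (<-trans (m%n<n j ℓ) (n>ℓ C))
    ρ⁺ = fromℕ< (≤-<-trans (m%n<n j ℓ) (n>ℓ C))
    ρ~j : cellAt (toℕ ρ) ≡ cellAt j
    ρ~j = ≡-mod⇒cellAt-≡ (trans (cong (_% ℓ) (toℕ-fromℕ< _)) (m%n%n≡m%n j ℓ))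
    ρ⁺~j⁺ : cellAt (toℕ ρ⁺) ≡ cellAt (suc j)
    ρ⁺~j⁺ = ≡-mod⇒cellAt-≡ (trans (cong (_% ℓ) (toℕ-fromℕ< _)) (suc-cong-mod ℓ (m%n%n≡m%n j ℓ)))

  cellAt-collinear-unique : ∀ d {a b c} → Collinear d (cellAt a) (cellAt b) → Collinear d (cellAt a) (cellAt c) →
                            cellAt a ≢ cellAt b → cellAt a ≢ cellAt c → cellAt b ≡ cellAt c
  cellAt-collinear-unique d = collinear-nonzero-unique cyc d (cellAt-nonzero _) (cellAt-nonzero _) (cellAt-nonzero _)

  -- The two lines through the cell of label a are those it shares with the
  -- cells of labels a - 1 (taken as a + (ℓ - 1)) and a + 1, and these three
  -- cells are distinct as ℓ ≥ 3.
  collinear-cellAt⇒consecutive : ∀ a b d → cellAt a ≢ cellAt b → Collinear d (cellAt a) (cellAt b) →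
                                 cellAt b ≡ cellAt (suc a) ⊎ cellAt a ≡ cellAt (suc b)
  collinear-cellAt⇒consecutive a b d a≁b ab =
    let e , a⁻a = cellAt-suc-collinear a⁻
        e′ , aa⁺ = cellAt-suc-collinear a
    in by-lines (line-pigeonhole d e e′) (trans (cong (lineOf e) (sym a⁻⁺~a)) (sym a⁻a)) aa⁺
    where
    a⁻ = a + pred ℓ

    a⁻⁺~a : cellAt (suc a⁻) ≡ cellAt a
    a⁻⁺~a = trans (cong cellAt (trans (sym (+-suc a (pred ℓ))) (cong (a +_) (suc-pred ℓ))))
                  (≡-mod⇒cellAt-≡ ([m+n]%n≡m%n a ℓ))

    a≁a⁻ : cellAt a ≢ cellAt a⁻
    a≁a⁻ = cellAt-distinct a⁻ z<s 1<ℓ ∘ trans a⁻⁺~a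

    a≁a⁺ : cellAt a ≢ cellAt (suc a)
    a≁a⁺ = cellAt-distinct a z<s 1<ℓ ∘ sym

    a⁻≁a⁺ : cellAt a⁻ ≢ cellAt (suc a)
    a⁻≁a⁺ a⁻~a⁺ = cellAt-distinct a⁻ z<s 2<ℓ (trans (cellAt-suc a⁻⁺~a) (sym a⁻~a⁺))

    by-lines : ∀ {e e′} → d ≡ e ⊎ d ≡ e′ ⊎ e ≡ e′ →
               Collinear e (cellAt a) (cellAt a⁻) → Collinear e′ (cellAt a) (cellAt (suc a)) →
               cellAt b ≡ cellAt (suc a) ⊎ cellAt a ≡ cellAt (suc b)
    by-lines (inj₁ refl) aa⁻ _ =
      inj₂ (trans (sym a⁻⁺~a) (cellAt-suc (cellAt-collinear-unique d aa⁻ ab a≁a⁻ a≁b)))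
    by-lines (inj₂ (inj₁ refl)) _ aa⁺ = inj₁ (sym (cellAt-collinear-unique d aa⁺ ab a≁a⁺ a≁b))
    by-lines {e} (inj₂ (inj₂ refl)) aa⁻ aa⁺ =
      contradiction (cellAt-collinear-unique e aa⁻ aa⁺ a≁a⁻ a≁a⁺) a⁻≁a⁺

  v-sameCell : ∀ {a b} → toℕ a % ℓ ≡ toℕ b % ℓ → cell (v C a) ≡ cell (v C b)
  v-sameCell {a} {b} a≡b = trans (cell-v a) (trans (≡-mod⇒cellAt-≡ a≡b) (sym (cell-v b)))

  v-sameCell-period : ∀ {a b} → toℕ a ≡ toℕ b + ℓ → cell (v C a) ≡ cell (v C b)
  v-sameCell-period {b = b} a≡ = v-sameCell (trans (cong (_% ℓ) a≡) ([m+n]%n≡m%n (toℕ b) ℓ))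

  v-sameCell-periods : ∀ q {a b} → toℕ a ≡ toℕ b + q * ℓ → cell (v C a) ≡ cell (v C b)
  v-sameCell-periods q {b = b} a≡ = v-sameCell (trans (cong (_% ℓ) a≡) ([m+kn]%n≡m%n (toℕ b) q ℓ))

  one-period-⊲ : ∀ a b → toℕ a ≡ toℕ b + ℓ → v C a ⊲ v C b
  one-period-⊲ a F.zero    a≡ℓ = arc⇒⊲ (C4 C a F.zero a≡ℓ refl)
  one-period-⊲ a (F.suc b) a≡  =
    ⊲-via-arc (v-sameCell-period a≡) (C3 C a b′ a≡b′+1+ℓ) (arc⇒⊲ (C2 C b′ (F.suc b) (cong suc (sym (toℕ-inject₁ b)))))
    where
    b′ = inject₁ b
    a≡b′+1+ℓ : toℕ a ≡ toℕ b′ + suc ℓ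
    a≡b′+1+ℓ = trans a≡ (trans (sym (+-suc (toℕ b) ℓ)) (cong (_+ suc ℓ) (sym (toℕ-inject₁ b))))

  periods-⊲ : ∀ q a b → toℕ a ≡ toℕ b + suc q * ℓ → v C a ⊲ v C b
  periods-⊲ zero    a b a≡ = one-period-⊲ a b (trans a≡ (cong (toℕ b +_) (+-identityʳ ℓ)))
  periods-⊲ (suc q) a b a≡ =
    let c , c≡ = earlier a (toℕ b + ℓ) a≡′
        a≡c+ = trans a≡′ (cong (_+ suc q * ℓ) (sym c≡))
    in ⊲-trans-sameCellˡ (v-sameCell-periods (suc q) a≡c+) (periods-⊲ q a c a≡c+) (one-period-⊲ c b c≡)
    where
    a≡′ : toℕ a ≡ (toℕ b + ℓ) + suc q * ℓ
    a≡′ = trans a≡ (sym (+-assoc (toℕ b) ℓ (suc q * ℓ)))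

  ⊲-through-periods : ∀ q a c {p} → toℕ a ≡ toℕ c + q * ℓ → v C c ⊲ p → v C a ⊲ p
  ⊲-through-periods zero    a c a≡c c⊲p =
    subst (_⊲ _) (cong (v C) (toℕ-injective (sym (trans a≡c (+-identityʳ (toℕ c)))))) c⊲p
  ⊲-through-periods (suc q) a c a≡  c⊲p =
    ⊲-trans-sameCellˡ (v-sameCell-periods (suc q) a≡) (periods-⊲ q a c a≡) c⊲p

  ⊲-if-cell[b]≡cell[1+a] : ∀ a b → cellAt (toℕ b) ≡ cellAt (suc (toℕ a)) → toℕ b < toℕ a → v C a ⊲ v C b
  ⊲-if-cell[b]≡cell[1+a] a b b~a⁺ b<a
    with ≡-mod⇒periods ℓ (m<n⇒m<1+n b<a) (cellAt-≡⇒≡-mod (sym b~a⁺))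
  ⊲-if-cell[b]≡cell[1+a] a F.zero _ _ | q , a⁺≡ =
    ⊲-through-periods q a last a≡ (⊲-trans-sameCellʳ (v-sameCell-period first≡ℓ) last⊲first first⊲zero)
    where
    first = fromℕ< (n>ℓ C)
    last  = fromℕ< (≤-<-trans pred[n]≤n (n>ℓ C))
    first≡ℓ : toℕ first ≡ ℓ
    first≡ℓ = toℕ-fromℕ< _
    last⁺≡ℓ : suc (toℕ last) ≡ ℓ
    last⁺≡ℓ = trans (cong suc (toℕ-fromℕ< _)) (suc-pred ℓ)
    a≡ : toℕ a ≡ toℕ last + q * ℓ
    a≡ = suc-injective (trans a⁺≡ (cong (_+ q * ℓ) (sym last⁺≡ℓ)))
    last⊲first = arc⇒⊲ (C2 C last first (trans first≡ℓ (sym last⁺≡ℓ)))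
    first⊲zero = arc⇒⊲ (C4 C first F.zero first≡ℓ refl)
  ⊲-if-cell[b]≡cell[1+a] a (F.suc b) _ _ | q , a⁺≡ =
    ⊲-through-periods (suc q) a b′ a≡ (arc⇒⊲ (C2 C b′ (F.suc b) (cong suc (sym (toℕ-inject₁ b)))))
    where
    b′ = inject₁ b
    a≡ : toℕ a ≡ toℕ b′ + suc q * ℓ
    a≡ = trans (suc-injective a⁺≡) (cong (_+ suc q * ℓ) (sym (toℕ-inject₁ b)))

  ⊲-if-cell[a]≡cell[1+b] : ∀ a b → cellAt (toℕ a) ≡ cellAt (suc (toℕ b)) → suc (toℕ b) < toℕ a → v C a ⊲ v C b
  ⊲-if-cell[a]≡cell[1+b] a b a~b⁺ b⁺<a with ≡-mod⇒periods ℓ b⁺<a (cellAt-≡⇒≡-mod a~b⁺)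
  ... | q , a≡ =
    let c , c≡ = earlier a (toℕ b + suc ℓ) a≡′
    in ⊲-through-periods q a c (trans a≡′ (cong (_+ q * ℓ) (sym c≡))) (arc⇒⊲ (C3 C c b c≡))
    where
    a≡′ : toℕ a ≡ (toℕ b + suc ℓ) + q * ℓ
    a≡′ = trans a≡ (trans (sym (+-assoc (suc (toℕ b)) ℓ (q * ℓ))) (cong (_+ q * ℓ) (sym (+-suc (toℕ b) ℓ))))

  ⊲-nonadjacent : ∀ a b → suc (toℕ b) < toℕ a → v C a ⊲ v C b
  ⊲-nonadjacent a b b⁺<a = case toℕ a % ℓ ℕ.≟ toℕ b % ℓ of λ where
      (yes a≡b) → let q , a≡ = ≡-mod⇒periods ℓ b<a a≡b in periods-⊲ q a b a≡
      (no a≢b) d ab →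
        [ (λ b~a⁺ → ⊲-if-cell[b]≡cell[1+a] a b b~a⁺ b<a d ab)
        , (λ a~b⁺ → ⊲-if-cell[a]≡cell[1+b] a b a~b⁺ b⁺<a d ab)
        ]′ (collinear-cellAt⇒consecutive (toℕ a) (toℕ b) d (a≢b ∘ cellAt-≡⇒≡-mod)
                                         (subst₂ (Collinear d) (cell-v a) (cell-v b) ab))
    where b<a = <-trans (n<1+n _) b⁺<a

module _ {m k n : ℕ} {M : GriddingMatrix m k} (O : PMM M) (π : Grid# M n)
         (v : Fin n → Fin n) (v-inj : ∀ a b → v a ≡ v b → a ≡ b) (v-sur : ∀ p → ∃[ a ] v a ≡ p) where

  open Orientation O π

  deletion-divisible : (∀ a b → suc (toℕ b) < toℕ a → v a ⊲ v b) →
    ∀ i → 0 < toℕ i → suc (toℕ i) < n →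
    IsMDivisibleVia O (delete π (v i))
      (λ p → ∃[ j ] (toℕ i < toℕ j × v j ≡ value p))
      (λ p → ∃[ j ] (toℕ j < toℕ i × v j ≡ value p))
  deletion-divisible ⊲-nonadjacent (F.suc i′) _ i⁺<n =
    (covers , disjoint , across colLine , across rowLine) ,
    (point i⁺ i⁺≢i , i⁺ , i<i⁺ , refl) ,
    (point i⁻ i⁻≢i , i⁻ , i⁻<i , refl)
    where
    i = F.suc i′

    Q : Fin n → Set
    Q p = p ≢ v i

    Later Earlier : Refinement (Fin n) Q → Set
    Later p   = ∃[ j ] (toℕ i < toℕ j × v j ≡ value p)
    Earlier p = ∃[ j ] (toℕ j < toℕ i × v j ≡ value p)

    covers : ∀ p → Later p ⊎ Earlier p
    covers (p , [ p≢vi ]) with v-sur p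
    ... | j , vj≡p with <-cmp (toℕ j) (toℕ i)
    ...   | tri< j<i _ _ = inj₂ (j , j<i , vj≡p)
    ...   | tri≈ _ j≡i _ = ⊥-elim-irr (p≢vi (trans (sym vj≡p) (cong v (toℕ-injective j≡i))))
    ...   | tri> _ _ i<j = inj₁ (j , i<j , vj≡p)

    disjoint : ∀ p → Later p → Earlier p → ⊥
    disjoint _ (j , i<j , vj≡p) (j′ , j′<i , vj′≡p) =
      <-irrefl (cong toℕ (v-inj j′ j (trans vj′≡p (sym vj≡p)))) (<-trans j′<i i<j)

    across : ∀ d s t → Later s → Earlier t → SameLine d (value s) (value t) → Precedes d (value s) (value t)
    across d (_ , _) (_ , _) (j , i<j , refl) (j′ , j′<i , refl) = ⊲-nonadjacent j j′ (≤-<-trans j′<i i<j) d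

    point : ∀ j → j ≢ i → Refinement (Fin n) Q
    point j j≢i = v j , [ j≢i ∘ v-inj j i ]

    i⁺ i⁻ : Fin n
    i⁺ = fromℕ< i⁺<n
    i⁻ = inject₁ i′

    i<i⁺ : toℕ i < toℕ i⁺
    i<i⁺ = ≤-reflexive (sym (toℕ-fromℕ< i⁺<n))

    i⁻<i : toℕ i⁻ < toℕ i
    i⁻<i = s≤s (≤-reflexive (toℕ-inject₁ i′))

    i⁺≢i : i⁺ ≢ i
    i⁺≢i = >⇒≢ i<i⁺ ∘ cong toℕ

    i⁻≢i : i⁻ ≢ i
    i⁻≢i = <⇒≢ i⁻<i ∘ cong toℕ

lemma3p9 : ∀ {m k : ℕ} (M : GriddingMatrix m k) (O : PMM M) (ℓ : ℕ) →
  IsCyclic M ℓ →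
  ∀ {n : ℕ} (π : Grid# M n) (C : IsCoil O ℓ π) (i : Fin n) →
  0 < toℕ i → suc (toℕ i) < n →
  IsMDivisibleVia O (delete π (v C i))
    (λ p → ∃[ j ] (toℕ i < toℕ j × v C j ≡ value p))
    (λ p → ∃[ j ] (toℕ j < toℕ i × v C j ≡ value p))
lemma3p9 M O ℓ cyc π C =
  deletion-divisible O π (v C) (v-inj C) (v-sur C) (Coil.⊲-nonadjacent O cyc C)
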